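{- Let $G$ be a bipartite graph. Then $G$ is a un2qBMG if and only if every connected induced subgraph of $G$ contains a heart-vertex.
   Context: A heart-vertex of a bipartite graph (with its bipartition viewed as a 2-coloring) is a vertex adjacent to all vertices of the opposite color class. For a rooted phylogenetic tree $T$ (root $\rho$, leaf set $L(T)$) with leaf-coloring $\sigma$ into two colors and truncation map $u$ assigning each leaf $x$ a vertex $u(x)$ on the path from $\rho$ to $x$, the 2-colored quasi-best match graph (2qBMG) is the digraph on $L(T)$ with arc $x\to y$ iff $\sigma(x)\ne\sigma(y)$, $\mathrm{lca}(x,y)$ is a descendant of or equal to $\mathrm{lca}(x,z)$ for all leaves $z$ with $\sigma(z)=\sigma(y)$, and $\mathrm{lca}(x,y)$ is a descendant of or equal to $u(x)$. A graph $G$ is a un2qBMG if, for some 2-coloring $\sigma$ of $V(G)$, it is the underlying undirected graph of the 2qBMG of some $(T,\sigma,u)$ with $L(T)=V(G)$. -}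

module Defs where

open import Data.Nat using (ℕ; zero; suc)
open import Data.Bool using (Bool; true; false)
open import Data.Fin using (Fin; _≟_)
open import Data.Product using (Σ; Σ-syntax; ∃; _×_; _,_)
open import Data.Sum using (_⊎_)
open import Relation.Nullary using (¬_; yes; no)
open import Relation.Binary.PropositionalEquality using (_≡_; _≢_; refl)
open import Function.Bundles using (_⇔_)

record Graph (n : ℕ) : Set where
  field
    adj    : Fin n → Fin n → Bool
    sym    : ∀ x y → adj x y ≡ adj y x
    irrefl : ∀ x → adj x x ≡ false

Edge : ∀ {n} → Graph n → Fin n → Fin n → Set
Edge G x y = Graph.adj G x y ≡ true

-- A vertex subset S (characteristic function); G[S] is the induced subgraph.
-- c is a proper 2-coloring (bipartition) of G[S].
ProperOn : ∀ {n} → Graph n → (Fin n → Bool) → (Fin n → Bool) → Set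
ProperOn G S c = ∀ x y → S x ≡ true → S y ≡ true → Edge G x y → c x ≢ c y

Bipartite : ∀ {n} → Graph n → Set
Bipartite {n} G = Σ[ c ∈ (Fin n → Bool) ] ProperOn G (λ _ → true) c

data Walk {n} (G : Graph n) (S : Fin n → Bool) : Fin n → Fin n → Set where
  stop : ∀ {x} → S x ≡ true → Walk G S x x
  step : ∀ {x y z} → S x ≡ true → Edge G x y → Walk G S y z → Walk G S x z

Connected : ∀ {n} → Graph n → (Fin n → Bool) → Set
Connected G S =
  (∃ λ x → S x ≡ true) ×
  (∀ x y → S x ≡ true → S y ≡ true → Walk G S x y)

IsHeart : ∀ {n} → Graph n → (Fin n → Bool) → (Fin n → Bool) → Fin n → Set
IsHeart G S c v =
  S v ≡ true × (∀ w → S w ≡ true → c w ≢ c v → Edge G v w)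

-- Rooted phylogenetic trees: every inner vertex has at least 2 children

data Tree : Set where
  leaf : Tree
  node : ∀ {k} → (Fin (suc (suc k)) → Tree) → Tree

-- vertices of a tree, given as paths from the root ρ
data Vtx : Tree → Set where
  root  : ∀ {t} → Vtx t
  child : ∀ {k} {f : Fin (suc (suc k)) → Tree} (i : Fin (suc (suc k))) →
          Vtx (f i) → Vtx (node f)

data _≼_ : ∀ {t} → Vtx t → Vtx t → Set where
  root≼  : ∀ {t} {v : Vtx t} → root ≼ v
  child≼ : ∀ {k} {f : Fin (suc (suc k)) → Tree} {i : Fin (suc (suc k))}
             {a b : Vtx (f i)} → a ≼ b → child {f = f} i a ≼ child i b

subtree : ∀ {t} → Vtx t → Tree
subtree {t} root = t
subtree (child i v) = subtree v

IsLeaf : ∀ {t} → Vtx t → Set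
IsLeaf v = subtree v ≡ leaf

lca : ∀ {t} → Vtx t → Vtx t → Vtx t
lca root _ = root
lca (child i a) root = root
lca (child i a) (child j b) with i ≟ j
... | yes refl = child i (lca a b)
... | no _ = root

record PhyloTree (n : ℕ) : Set where
  field
    tree       : Tree
    label      : Fin n → Vtx tree
    label-leaf : ∀ x → IsLeaf (label x)
    label-inj  : ∀ x y → label x ≡ label y → x ≡ y
    label-surj : ∀ v → IsLeaf v → ∃ λ x → label x ≡ v

open PhyloTree public

Truncation : ∀ {n} → PhyloTree n → Set
Truncation {n} T = Σ[ u ∈ (Fin n → Vtx (tree T)) ] (∀ x → u x ≼ label T x)

Arc : ∀ {n} (T : PhyloTree n) → (Fin n → Bool) → Truncation T →
      Fin n → Fin n → Set
Arc T σ (u , _) x y =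
  σ x ≢ σ y ×
  (∀ z → σ z ≡ σ y → lca (ℓ x) (ℓ z) ≼ lca (ℓ x) (ℓ y)) ×
  (u x ≼ lca (ℓ x) (ℓ y))
  where ℓ = label T

Un2qBMG : ∀ {n} → Graph n → Set
Un2qBMG {n} G =
  Σ[ σ ∈ (Fin n → Bool) ] Σ[ T ∈ PhyloTree n ] Σ[ u ∈ Truncation T ]
    (∀ x y → Edge G x y ⇔ (Arc T σ u x y ⊎ Arc T σ u y x))

EveryConnectedInducedHasHeart : ∀ {n} → Graph n → Set
EveryConnectedInducedHasHeart {n} G =
  ∀ (S : Fin n → Bool) → Connected G S →
  ∀ (c : Fin n → Bool) → ProperOn G S c →
  ∃ λ v → IsHeart G S c v

-- (⇒) Let (T, σ, u) explain G and let G[S] be connected with bipartition c. Since G[S] is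
-- connected, c agrees with σ up to swapping the colours. Take an arc a → b inside S. If some
-- vertex of S is not below w = lca(a, b), a walk to it leaves the subtree of w along an edge,
-- and the lca of the corresponding arc lies strictly above w; so after finitely many steps
-- S lies below w. Then every z of the other colour class satisfies the best-match and
-- truncation conditions of b, hence a → z is an arc and a is a heart-vertex.
--
-- (⇐) By induction on |S| we build a tree explaining G[S], where best matches are sought
-- only in S. If G[S] is disconnected, the trees of a component and of the rest are hung
-- below a new root, so no arc crosses. Otherwise G[S] has a heart v; the tree of G[S − v]
-- and the leaf v are hung below a new root with u(v) = root, so the arcs out of v go to
-- exactly the vertices of the other colour, which are the neighbours of v.

module Submission where

open import Defs
open import Data.Bool using (Bool; true; false; not; _∧_; _∨_; _xor_)
open import Data.Bool.Properties using (¬-not; xor-annihilates-not; ∧-zeroʳ; ∨-zeroʳ)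
  renaming (_≟_ to _≟ᵇ_)
open import Data.Empty using (⊥-elim)
open import Data.Fin using (Fin; zero; suc; _≟_)
open import Data.Fin.Properties using (any?)
import Data.Fin.Subset as Subset
open import Data.Fin.Subset.Properties using (∣p∣≤n; p⊂q⇒∣p∣<∣q∣)
open import Data.Nat using (ℕ; zero; suc; _+_; _≤_; _<_; z≤n; s≤s)
open import Data.Nat.Properties
  using (module ≤-Reasoning; ≤-trans; <-≤-trans; n<1+n; <⇒≱; +-identityʳ; +-suc; +-monoˡ-≤; m≤n+m)
open import Data.Product using (Σ-syntax; ∃; _×_; _,_; proj₁)
open import Data.Sum using (_⊎_; inj₁; inj₂; swap)
open import Data.Sum.Function.Propositional using (_⊎-⇔_)
open import Data.Vec using (tabulate)
open import Data.Vec.Properties using (lookup∘tabulate; []=⇒lookup; lookup⇒[]=)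
open import Function using (case_of_)
open import Function.Bundles using (_⇔_; mk⇔; Equivalence)
open import Function.Construct.Composition using (_⇔-∘_)
open import Relation.Nullary using (¬_; yes; no; Dec; does)
open import Relation.Nullary.Decidable using (_×-dec_; ¬?; decidable-stable; dec-true; dec-false)
open import Relation.Binary.PropositionalEquality
  using (_≡_; _≢_; refl; sym; trans; cong; cong₂; subst; subst₂; module ≡-Reasoning)

-- Rooted trees

≼-trans : ∀ {t} {a b c : Vtx t} → a ≼ b → b ≼ c → a ≼ c
≼-trans root≼      _          = root≼
≼-trans (child≼ p) (child≼ q) = child≼ (≼-trans p q)

child≼-inv : ∀ {k} {f : Fin (suc (suc k)) → Tree} {i} {a b : Vtx (f i)} →
             child {f = f} i a ≼ child i b → a ≼ b
child≼-inv (child≼ p) = p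

child-injective : ∀ {k} {f : Fin (suc (suc k)) → Tree} {i} {a b : Vtx (f i)} →
                  child {f = f} i a ≡ child i b → a ≡ b
child-injective refl = refl

_≼?_ : ∀ {t} (a b : Vtx t) → Dec (a ≼ b)
root      ≼? b    = yes root≼
child i a ≼? root = no λ ()
child i a ≼? child j b with i ≟ j
... | no i≢j = no λ { (child≼ _) → i≢j refl }
... | yes refl with a ≼? b
...   | yes a≼b = yes (child≼ a≼b)
...   | no  a⋠b = no λ p → a⋠b (child≼-inv p)

lca-child-≡ : ∀ {k} {f : Fin (suc (suc k)) → Tree} i (a b : Vtx (f i)) →
              lca (child {f = f} i a) (child i b) ≡ child i (lca a b)
lca-child-≡ i a b with i ≟ i
... | yes refl = refl
... | no  i≢i  = ⊥-elim (i≢i refl)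

lca-≼ˡ : ∀ {t} (a b : Vtx t) → lca a b ≼ a
lca-≼ˡ root        b           = root≼
lca-≼ˡ (child i a) root        = root≼
lca-≼ˡ (child i a) (child j b) with i ≟ j
... | yes refl = child≼ (lca-≼ˡ a b)
... | no  _    = root≼

lca-≼ʳ : ∀ {t} (a b : Vtx t) → lca a b ≼ b
lca-≼ʳ root        b           = root≼
lca-≼ʳ (child i a) root        = root≼
lca-≼ʳ (child i a) (child j b) with i ≟ j
... | yes refl = child≼ (lca-≼ʳ a b)
... | no  _    = root≼

≼-lca : ∀ {t} {w a b : Vtx t} → w ≼ a → w ≼ b → w ≼ lca a b
≼-lca root≼ _ = root≼
≼-lca (child≼ {i = i} {b = a} p) (child≼ {b = b} q) =
  subst (_ ≼_) (sym (lca-child-≡ i a b)) (child≼ (≼-lca p q))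

≼-linear : ∀ {t} {a b c : Vtx t} → a ≼ c → b ≼ c → a ≼ b ⊎ b ≼ a
≼-linear root≼      _          = inj₁ root≼
≼-linear (child≼ p) root≼      = inj₂ root≼
≼-linear (child≼ p) (child≼ q) with ≼-linear p q
... | inj₁ a≼b = inj₁ (child≼ a≼b)
... | inj₂ b≼a = inj₂ (child≼ b≼a)

depth : ∀ {t} → Vtx t → ℕ
depth root        = 0
depth (child _ a) = suc (depth a)

depth-< : ∀ {t} {a b : Vtx t} → a ≼ b → ¬ b ≼ a → depth a < depth b
depth-< {b = root}      root≼      b⋠a = ⊥-elim (b⋠a root≼)
depth-< {b = child _ _} root≼      _   = s≤s z≤n
depth-<                 (child≼ p) b⋠a = s≤s (depth-< p λ q → b⋠a (child≼ q))

common-ancestor-above : ∀ {t} {w a b c : Vtx t} →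
  w ≼ a → ¬ w ≼ b → c ≼ a → c ≼ b → depth c < depth w
common-ancestor-above w≼a w⋠b c≼a c≼b with ≼-linear c≼a w≼a
... | inj₁ c≼w = depth-< c≼w λ w≼c → w⋠b (≼-trans w≼c c≼b)
... | inj₂ w≼c = ⊥-elim (w⋠b (≼-trans w≼c c≼b))

edge-sym : ∀ {n} {G : Graph n} {x y} → Edge G x y → Edge G y x
edge-sym {G = G} {x} {y} e = trans (Graph.sym G y x) e

edge-irrefl : ∀ {n} {G : Graph n} {x} → ¬ Edge G x x
edge-irrefl {G = G} {x} e with trans (sym e) (Graph.irrefl G x)
... | ()

module _ {n} {G : Graph n} {S : Fin n → Bool} where

  walk-source : ∀ {x y} → Walk G S x y → S x ≡ true
  walk-source (stop s)     = s
  walk-source (step s _ _) = s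

  walk-snoc : ∀ {x y z} → Walk G S x y → S z ≡ true → Edge G y z → Walk G S x z
  walk-snoc (stop sx)     sz e = step sx e (stop sz)
  walk-snoc (step sx d w) sz e = step sx d (walk-snoc w sz e)

  walk-reverse-onto : ∀ {x y z} → Walk G S x y → Walk G S x z → Walk G S y z
  walk-reverse-onto (stop _)     acc = acc
  walk-reverse-onto (step sx e w) acc = walk-reverse-onto w (step (walk-source w) (edge-sym {G = G} e) acc)

xor-cancelʳ : ∀ {a a′ b} → a xor b ≡ a′ xor b → a ≡ a′
xor-cancelʳ {false} {false}         _ = refl
xor-cancelʳ {true}  {true}          _ = refl
xor-cancelʳ {false} {true}  {false} ()
xor-cancelʳ {false} {true}  {true}  ()
xor-cancelʳ {true}  {false} {false} ()
xor-cancelʳ {true}  {false} {true}  ()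

xor-≢ : ∀ {a a′ b b′} → a xor b ≡ a′ xor b′ → a ≢ a′ → b ≢ b′
xor-≢ eq a≢a′ refl = a≢a′ (xor-cancelʳ eq)

xor-both-flipped : ∀ {a a′ b b′} → a′ ≢ a → b′ ≢ b → a xor b ≡ a′ xor b′
xor-both-flipped {a} {a′} {b} {b′} a′≢a b′≢b = begin
  a xor b             ≡⟨ sym (xor-annihilates-not a b) ⟩
  not a xor not b     ≡⟨ cong₂ _xor_ (sym (¬-not a′≢a)) (sym (¬-not b′≢b)) ⟩
  a′ xor b′           ∎
  where open ≡-Reasoning

true-or-false : ∀ b → b ≡ true ⊎ b ≡ false
true-or-false true  = inj₁ refl
true-or-false false = inj₂ refl

both-absurd : ∀ {a b} {A : Set a} {B : Set b} → ¬ A → ¬ B → A ⇔ B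
both-absurd ¬a ¬b = mk⇔ (λ a → ⊥-elim (¬a a)) (λ b → ⊥-elim (¬b b))

∧-intro : ∀ {a b} → a ≡ true → b ≡ true → a ∧ b ≡ true
∧-intro refl refl = refl

∧-elim : ∀ a {b} → a ∧ b ≡ true → a ≡ true × b ≡ true
∧-elim true e = refl , e

∨-elim : ∀ a {b} → a ∨ b ≡ true → a ≡ true ⊎ b ≡ true
∨-elim true  _ = inj₁ refl
∨-elim false e = inj₂ e

does⇒ : ∀ {p} {P : Set p} (d : Dec P) → does d ≡ true → P
does⇒ (yes p) _ = p

-- Heart-vertices in 2qBMGs

module Hearts {n} (G : Graph n) (σ : Fin n → Bool) (T : PhyloTree n) (U : Truncation T)
  (explains : ∀ x y → Edge G x y ⇔ (Arc T σ U x y ⊎ Arc T σ U y x)) where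

  ℓ : Fin n → Vtx (tree T)
  ℓ = label T

  edge-colours : ∀ {x y} → Edge G x y → σ x ≢ σ y
  edge-colours {x} {y} e with Equivalence.to (explains x y) e
  ... | inj₁ (σx≢σy , _) = σx≢σy
  ... | inj₂ (σy≢σx , _) = λ eq → σy≢σx (sym eq)

  module _ (S : Fin n → Bool) (c : Fin n → Bool) (c-proper : ProperOn G S c) where

    colour-parity : ∀ {x y} → Walk G S x y → c x xor σ x ≡ c y xor σ y
    colour-parity (stop _) = refl
    colour-parity (step {x = x} {y} sx e w) =
      trans (xor-both-flipped (λ eq → c-proper x y sx (walk-source w) e (sym eq))
                             (λ eq → edge-colours e (sym eq)))
            (colour-parity w)

    record ArcWithin : Set where
      constructor arcWithin
      field
        {tail head} : Fin n
        tail∈S      : S tail ≡ true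
        head∈S      : S head ≡ true
        arc         : Arc T σ U tail head

      top : Vtx (tree T)
      top = lca (ℓ tail) (ℓ head)

    edge⇒arcWithin : ∀ {x y} → S x ≡ true → S y ≡ true → Edge G x y →
                     Σ[ α ∈ ArcWithin ] ArcWithin.top α ≼ ℓ x × ArcWithin.top α ≼ ℓ y
    edge⇒arcWithin {x} {y} sx sy e with Equivalence.to (explains x y) e
    ... | inj₁ xy = arcWithin sx sy xy , lca-≼ˡ (ℓ x) (ℓ y) , lca-≼ʳ (ℓ x) (ℓ y)
    ... | inj₂ yx = arcWithin sy sx yx , lca-≼ʳ (ℓ y) (ℓ x) , lca-≼ˡ (ℓ y) (ℓ x)

    record ExitEdge (w : Vtx (tree T)) : Set where
      constructor exitEdge
      field
        {inner outer} : Fin n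
        inner∈S       : S inner ≡ true
        outer∈S       : S outer ≡ true
        edge          : Edge G inner outer
        inner-below   : w ≼ ℓ inner
        outer-outside : ¬ w ≼ ℓ outer

    exit-edge : ∀ w {a z} → Walk G S a z → w ≼ ℓ a → ¬ w ≼ ℓ z → ExitEdge w
    exit-edge w (stop _) w≼a w⋠z = ⊥-elim (w⋠z w≼a)
    exit-edge w (step {y = y} sa e walk) w≼a w⋠z with w ≼? ℓ y
    ... | yes w≼y = exit-edge w walk w≼y w⋠z
    ... | no  w⋠y = exitEdge sa (walk-source walk) e w≼a w⋠y

    exit-arc : ∀ {w} → ExitEdge w → Σ[ α ∈ ArcWithin ] depth (ArcWithin.top α) < depth w
    exit-arc (exitEdge sp sq e w≼p w⋠q) =
      let α , top≼p , top≼q = edge⇒arcWithin sp sq e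
      in α , common-ancestor-above w≼p w⋠q top≼p top≼q

    module _ (connected : ∀ x y → S x ≡ true → S y ≡ true → Walk G S x y) where

      -- If S lies below lca(a, b) for an arc a → b, every z of the other colour class has
      -- σ z = σ b and lca(a, b) ≼ lca(a, z), so a → z is an arc too.
      covering-arc⇒heart : (α : ArcWithin) → (∀ z → S z ≡ true → ArcWithin.top α ≼ ℓ z) →
                           IsHeart G S c (ArcWithin.tail α)
      covering-arc⇒heart (arcWithin {a} {b} sa _ (σa≢σb , best , truncated)) covers =
        sa , λ z sz cz≢ca →
          let σz≢σa = xor-≢ (colour-parity (connected z a sz sa)) cz≢ca
              σz≡σb = trans (¬-not σz≢σa) (sym (¬-not (λ eq → σa≢σb (sym eq))))
              top≼az = ≼-lca (lca-≼ˡ (ℓ a) (ℓ b)) (covers z sz)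
          in Equivalence.from (explains a z) (inj₁
               ( (λ eq → σz≢σa (sym eq))
               , (λ z′ σz′ → ≼-trans (best z′ (trans σz′ σz≡σb)) top≼az)
               , ≼-trans truncated top≼az ))

      heart-below : ∀ k (α : ArcWithin) → depth (ArcWithin.top α) < k → ∃ (IsHeart G S c)
      heart-below (suc k) α (s≤s top≤k)
        with any? (λ z → (S z ≟ᵇ true) ×-dec ¬? (ArcWithin.top α ≼? ℓ z))
      ... | no none = ArcWithin.tail α , covering-arc⇒heart α λ z sz →
                        decidable-stable (_ ≼? ℓ z) λ top⋠z → none (z , sz , top⋠z)
      ... | yes (z , sz , top⋠z) =
        let open ArcWithin α
            β , β<α = exit-arc (exit-edge top (connected tail z tail∈S sz)
                                          (lca-≼ˡ (ℓ tail) (ℓ head)) top⋠z)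
        in heart-below k β (≤-trans β<α top≤k)

      heart-exists : ∀ {x₀} → S x₀ ≡ true → ∃ (IsHeart G S c)
      heart-exists {x₀} s₀ with any? (λ y → (S y ≟ᵇ true) ×-dec (Graph.adj G x₀ y ≟ᵇ true))
      ... | yes (y , sy , e) = heart-below _ (proj₁ (edge⇒arcWithin s₀ sy e)) (n<1+n _)
      ... | no isolated = x₀ , s₀ , λ z sz cz≢c₀ → isolated-heart (connected x₀ z s₀ sz) cz≢c₀
        where
          isolated-heart : ∀ {z} → Walk G S x₀ z → c z ≢ c x₀ → Edge G x₀ z
          isolated-heart (stop _)     c≢ = ⊥-elim (c≢ refl)
          isolated-heart (step _ e w) _  = ⊥-elim (isolated (_ , walk-source w , e))

forward : ∀ {n} (G : Graph n) → Un2qBMG G → EveryConnectedInducedHasHeart G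
forward G (σ , T , U , explains) S ((_ , s₀) , connected) c c-proper =
  Hearts.heart-exists G σ T U explains S c c-proper connected s₀

_⊆_ : ∀ {n} → (Fin n → Bool) → (Fin n → Bool) → Set
S ⊆ S′ = ∀ x → S x ≡ true → S′ x ≡ true

-- Opaque so that S and S′ can be inferred from types mentioning S ∖ S′ or size S.
opaque
  _∖_ : ∀ {n} → (Fin n → Bool) → (Fin n → Bool) → Fin n → Bool
  (S ∖ S′) x = S x ∧ not (S′ x)

  ⁅_⁆ : ∀ {n} → Fin n → Fin n → Bool
  ⁅ v ⁆ x = does (x ≟ v)

  x∈⁅x⁆ : ∀ {n} (x : Fin n) → ⁅ x ⁆ x ≡ true
  x∈⁅x⁆ x = dec-true (x ≟ x) refl

  x∈⁅y⁆⇒x≡y : ∀ {n} {x y : Fin n} → ⁅ y ⁆ x ≡ true → x ≡ y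
  x∈⁅y⁆⇒x≡y {x = x} {y} with x ≟ y
  ... | yes x≡y = λ _ → x≡y

  x≢y⇒x∉⁅y⁆ : ∀ {n} {x y : Fin n} → x ≢ y → ⁅ y ⁆ x ≡ false
  x≢y⇒x∉⁅y⁆ {x = x} {y} = dec-false (x ≟ y)

  ∖-⊆ : ∀ {n} {S S′ : Fin n → Bool} → (S ∖ S′) ⊆ S
  ∖-⊆ {S = S} x e with S x
  ... | true = refl

  ∈∖⇒∉ : ∀ {n} {S S′ : Fin n → Bool} {x} → (S ∖ S′) x ≡ true → S′ x ≡ false
  ∈∖⇒∉ {S = S} {S′} {x} e with S x | S′ x
  ... | true | false = refl

  ∈∉⇒∈∖ : ∀ {n} {S S′ : Fin n → Bool} {x} → S x ≡ true → S′ x ≡ false → (S ∖ S′) x ≡ true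
  ∈∉⇒∈∖ sx s′x rewrite sx | s′x = refl

  ∉∖⇒∈ : ∀ {n} {S S′ : Fin n → Bool} {x} → S x ≡ true → (S ∖ S′) x ≡ false → S′ x ≡ true
  ∉∖⇒∈ {S′ = S′} {x} sx e with S′ x
  ... | true = refl
  ... | false rewrite sx = case e of λ ()

  ∈⇒∉∖ : ∀ {n} {S S′ : Fin n → Bool} {x} → S′ x ≡ true → (S ∖ S′) x ≡ false
  ∈⇒∉∖ {S = S} {x = x} e rewrite e = ∧-zeroʳ (S x)

opaque
  size : ∀ {n} → (Fin n → Bool) → ℕ
  size S = Subset.∣ tabulate S ∣

  ∈-tabulate : ∀ {n} {S : Fin n → Bool} {x} → S x ≡ true → x Subset.∈ tabulate S
  ∈-tabulate {S = S} {x} e = lookup⇒[]= x (tabulate S) (trans (lookup∘tabulate S x) e)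

  tabulate-∈ : ∀ {n} {S : Fin n → Bool} {x} → x Subset.∈ tabulate S → S x ≡ true
  tabulate-∈ {S = S} {x} x∈ = trans (sym (lookup∘tabulate S x)) ([]=⇒lookup x∈)

  size≤n : ∀ {n} (S : Fin n → Bool) → size S ≤ n
  size≤n S = ∣p∣≤n (tabulate S)

  size-< : ∀ {n} {S S′ : Fin n → Bool} {y} → S ⊆ S′ → S′ y ≡ true → S y ≡ false → size S < size S′
  size-< {S = S} {S′} {y} S⊆S′ s′y sy =
    p⊂q⇒∣p∣<∣q∣ ( (λ x∈ → ∈-tabulate (S⊆S′ _ (tabulate-∈ x∈)))
                , y , ∈-tabulate s′y , λ y∈ → case trans (sym sy) (tabulate-∈ y∈) of λ ())

-- Arcs of the 2qBMG of an induced subgraph G[S]: best matches are sought only in S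

module _ {n} (σ : Fin n → Bool) where

  record ArcOn (S : Fin n → Bool) {t : Tree} (ℓ u : Fin n → Vtx t) (x y : Fin n) : Set where
    constructor arcOn
    field
      colours   : σ x ≢ σ y
      best      : ∀ z → S z ≡ true → σ z ≡ σ y → lca (ℓ x) (ℓ z) ≼ lca (ℓ x) (ℓ y)
      truncated : u x ≼ lca (ℓ x) (ℓ y)

  LinkOn : (S : Fin n → Bool) {t : Tree} (ℓ u : Fin n → Vtx t) → Fin n → Fin n → Set
  LinkOn S ℓ u x y = ArcOn S ℓ u x y ⊎ ArcOn S ℓ u y x

  ¬LinkOn-loop : ∀ {S t} {ℓ u : Fin n → Vtx t} {x} → ¬ LinkOn S ℓ u x x
  ¬LinkOn-loop (inj₁ (arcOn σx≢σx _ _)) = σx≢σx refl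
  ¬LinkOn-loop (inj₂ (arcOn σx≢σx _ _)) = σx≢σx refl

  ¬ArcOn-above-truncation : ∀ {S k} {f : Fin (suc (suc k)) → Tree} {ℓ u : Fin n → Vtx (node f)}
    {x y i} {a : Vtx (f i)} → u x ≡ child i a → lca (ℓ x) (ℓ y) ≡ root → ¬ ArcOn S ℓ u x y
  ¬ArcOn-above-truncation ux≡ lca≡root (arcOn _ _ u≼lca) with subst₂ _≼_ ux≡ lca≡root u≼lca
  ... | ()

  -- Arcs inside branch i of the root, when the rest of S lies in other branches.
  module Branch {k} {f : Fin (suc (suc k)) → Tree} (i : Fin (suc (suc k)))
    {S Sᵢ : Fin n → Bool} (Sᵢ⊆S : Sᵢ ⊆ S)
    {ℓ u : Fin n → Vtx (node f)} {ℓᵢ uᵢ : Fin n → Vtx (f i)}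
    (ℓ-branch : ∀ {x} → Sᵢ x ≡ true → ℓ x ≡ child i (ℓᵢ x))
    (u-branch : ∀ {x} → Sᵢ x ≡ true → u x ≡ child i (uᵢ x))
    (lca-outside : ∀ {x z} → Sᵢ x ≡ true → S z ≡ true → Sᵢ z ≡ false → lca (ℓ x) (ℓ z) ≡ root)
    where

    lca-inside : ∀ {x y} → Sᵢ x ≡ true → Sᵢ y ≡ true →
                 lca (ℓ x) (ℓ y) ≡ child i (lca (ℓᵢ x) (ℓᵢ y))
    lca-inside sx sy = trans (cong₂ lca (ℓ-branch sx) (ℓ-branch sy)) (lca-child-≡ i _ _)

    arcOn⇔ : ∀ {x y} → Sᵢ x ≡ true → Sᵢ y ≡ true → ArcOn Sᵢ ℓᵢ uᵢ x y ⇔ ArcOn S ℓ u x y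
    arcOn⇔ {x} {y} sx sy = mk⇔ lift lower
      where
        lower : ArcOn S ℓ u x y → ArcOn Sᵢ ℓᵢ uᵢ x y
        lower (arcOn σx≢σy best u≼lca) = arcOn
            σx≢σy
            (λ z sz σz → child≼-inv (subst₂ _≼_ (lca-inside sx sz) (lca-inside sx sy)
                                                 (best z (Sᵢ⊆S z sz) σz)))
            (child≼-inv (subst₂ _≼_ (u-branch sx) (lca-inside sx sy) u≼lca))

        lift : ArcOn Sᵢ ℓᵢ uᵢ x y → ArcOn S ℓ u x y
        lift (arcOn σx≢σy best u≼lca) =
          arcOn σx≢σy best′ (subst₂ _≼_ (sym (u-branch sx)) (sym (lca-inside sx sy)) (child≼ u≼lca))
          where
            best′ : ∀ z → S z ≡ true → σ z ≡ σ y → lca (ℓ x) (ℓ z) ≼ lca (ℓ x) (ℓ y)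
            best′ z sz σz with Sᵢ z in e
            ... | true  = subst₂ _≼_ (sym (lca-inside sx e)) (sym (lca-inside sx sy))
                                     (child≼ (best z e σz))
            ... | false = subst (_≼ _) (sym (lca-outside sx sz e)) root≼

    linkOn⇔ : ∀ {x y} → Sᵢ x ≡ true → Sᵢ y ≡ true → LinkOn Sᵢ ℓᵢ uᵢ x y ⇔ LinkOn S ℓ u x y
    linkOn⇔ sx sy = arcOn⇔ sx sy ⊎-⇔ arcOn⇔ sy sx

record Labelling {n} (S : Fin n → Bool) : Set where
  field
    shape       : Tree
    ℓ           : Fin n → Vtx shape
    ℓ-leaf      : ∀ x → S x ≡ true → IsLeaf (ℓ x)
    ℓ-injective : ∀ x y → S x ≡ true → S y ≡ true → ℓ x ≡ ℓ y → x ≡ y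
    ℓ-onto      : ∀ w → IsLeaf w → ∃ λ x → S x ≡ true × ℓ x ≡ w

point : ∀ {n} {S : Fin n → Bool} {v} → S v ≡ true → (∀ y → S y ≡ true → y ≡ v) → Labelling S
point sv only = record
  { shape       = leaf
  ; ℓ           = λ _ → root
  ; ℓ-leaf      = λ _ _ → refl
  ; ℓ-injective = λ x y sx sy _ → trans (only x sx) (sym (only y sy))
  ; ℓ-onto      = λ { root _ → _ , sv , refl }
  }

pair : Tree → Tree → Fin 2 → Tree
pair a b zero       = a
pair a b (suc zero) = b

module Join {n} {S S₁ : Fin n → Bool} (S₁⊆S : S₁ ⊆ S)
  (L₁ : Labelling S₁) (L₂ : Labelling (S ∖ S₁)) where

  private
    module L₁ = Labelling L₁
    module L₂ = Labelling L₂

  shape : Tree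
  shape = node (pair L₁.shape L₂.shape)

  branch : Bool → Vtx L₁.shape → Vtx L₂.shape → Vtx shape
  branch true  a _ = child zero a
  branch false _ b = child (suc zero) b

  ℓ : Fin n → Vtx shape
  ℓ x = branch (S₁ x) (L₁.ℓ x) (L₂.ℓ x)

  ℓ-left : ∀ {x} → S₁ x ≡ true → ℓ x ≡ child zero (L₁.ℓ x)
  ℓ-left {x} e = cong (λ s → branch s (L₁.ℓ x) (L₂.ℓ x)) e

  ℓ-right : ∀ {x} → S₁ x ≡ false → ℓ x ≡ child (suc zero) (L₂.ℓ x)
  ℓ-right {x} e = cong (λ s → branch s (L₁.ℓ x) (L₂.ℓ x)) e

  lca-left-right : ∀ {x z} → S₁ x ≡ true → S₁ z ≡ false → lca (ℓ x) (ℓ z) ≡ root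
  lca-left-right ex ez = cong₂ lca (ℓ-left ex) (ℓ-right ez)

  lca-right-left : ∀ {x z} → S₁ x ≡ false → S₁ z ≡ true → lca (ℓ x) (ℓ z) ≡ root
  lca-right-left ex ez = cong₂ lca (ℓ-right ex) (ℓ-left ez)

  labelling : Labelling S
  labelling = record
    { shape = shape ; ℓ = ℓ ; ℓ-leaf = ℓ-leaf ; ℓ-injective = ℓ-injective ; ℓ-onto = ℓ-onto }
    where
      ℓ-leaf : ∀ x → S x ≡ true → IsLeaf (ℓ x)
      ℓ-leaf x sx with S₁ x in e
      ... | true  = L₁.ℓ-leaf x e
      ... | false = L₂.ℓ-leaf x (∈∉⇒∈∖ sx e)

      ℓ-injective : ∀ x y → S x ≡ true → S y ≡ true → ℓ x ≡ ℓ y → x ≡ y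
      ℓ-injective x y sx sy eq with S₁ x in ex | S₁ y in ey
      ... | true  | true  = L₁.ℓ-injective x y ex ey (child-injective eq)
      ... | false | false = L₂.ℓ-injective x y (∈∉⇒∈∖ sx ex) (∈∉⇒∈∖ sy ey) (child-injective eq)
      ... | true  | false = case eq of λ ()
      ... | false | true  = case eq of λ ()

      ℓ-onto : ∀ w → IsLeaf w → ∃ λ x → S x ≡ true × ℓ x ≡ w
      ℓ-onto (child zero w) l with L₁.ℓ-onto w l
      ... | x , s₁x , eq = x , S₁⊆S x s₁x , trans (ℓ-left s₁x) (cong (child zero) eq)
      ℓ-onto (child (suc zero) w) l with L₂.ℓ-onto w l
      ... | x , s₂x , eq = x , ∖-⊆ x s₂x , trans (ℓ-right (∈∖⇒∉ s₂x)) (cong (child (suc zero)) eq)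

-- Trees for graphs with hearts

module Construction {n} (G : Graph n) (σ : Fin n → Bool)
  (σ-proper : ∀ {x y} → Edge G x y → σ x ≢ σ y) where

  record Representation (S : Fin n → Bool) : Set where
    field
      labelling : Labelling S
    open Labelling labelling public
    field
      u        : Fin n → Vtx shape
      u≼ℓ      : ∀ x → u x ≼ ℓ x
      explains : ∀ {x y} → S x ≡ true → S y ≡ true → Edge G x y ⇔ LinkOn σ S ℓ u x y

  module _ {S : Fin n → Bool} {t} {ℓ u : Fin n → Vtx t} where

    explains-loop : ∀ {x} → Edge G x x ⇔ LinkOn σ S ℓ u x x
    explains-loop = both-absurd (edge-irrefl {G = G}) (¬LinkOn-loop σ)

    explains-sym : ∀ {x y} → Edge G x y ⇔ LinkOn σ S ℓ u x y → Edge G y x ⇔ LinkOn σ S ℓ u y x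
    explains-sym xy = mk⇔ (λ e → swap (Equivalence.to xy (edge-sym {G = G} e)))
                          (λ l → edge-sym {G = G} (Equivalence.from xy (swap l)))

  singleton : ∀ {S v} → S v ≡ true → (∀ y → S y ≡ true → y ≡ v) → Representation S
  singleton {S} sv only = record
    { labelling = point sv only
    ; u         = λ _ → root
    ; u≼ℓ       = λ _ → root≼
    ; explains  = λ {x} {y} sx sy →
        subst (λ y → Edge G x y ⇔ LinkOn σ S _ _ x y)
              (trans (only x sx) (sym (only y sy))) explains-loop
    }

  union : ∀ {S S₁} → S₁ ⊆ S →
          (∀ {x y} → S₁ x ≡ true → (S ∖ S₁) y ≡ true → ¬ Edge G x y) →
          Representation S₁ → Representation (S ∖ S₁) → Representation S
  union {S} {S₁} S₁⊆S separated R₁ R₂ = record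
    { labelling = labelling ; u = u ; u≼ℓ = u≼ℓ ; explains = explains }
    where
      module R₁ = Representation R₁
      module R₂ = Representation R₂
      open Join S₁⊆S R₁.labelling R₂.labelling

      u : Fin n → Vtx shape
      u x = branch (S₁ x) (R₁.u x) (R₂.u x)

      u≼ℓ : ∀ x → u x ≼ ℓ x
      u≼ℓ x with S₁ x
      ... | true  = child≼ (R₁.u≼ℓ x)
      ... | false = child≼ (R₂.u≼ℓ x)

      u-left : ∀ {x} → S₁ x ≡ true → u x ≡ child zero (R₁.u x)
      u-left {x} e = cong (λ s → branch s (R₁.u x) (R₂.u x)) e

      u-right : ∀ {x} → S₁ x ≡ false → u x ≡ child (suc zero) (R₂.u x)
      u-right {x} e = cong (λ s → branch s (R₁.u x) (R₂.u x)) e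

      module Left  = Branch σ zero S₁⊆S ℓ-left u-left (λ sx _ ez → lca-left-right sx ez)
      module Right = Branch σ (suc zero) ∖-⊆ (λ e → ℓ-right (∈∖⇒∉ e)) (λ e → u-right (∈∖⇒∉ e))
                       (λ sx sz ez → lca-right-left (∈∖⇒∉ sx) (∉∖⇒∈ sz ez))

      no-link-across : ∀ {x y} → S₁ x ≡ true → S₁ y ≡ false → ¬ LinkOn σ S ℓ u x y
      no-link-across ex ey (inj₁ xy) = ¬ArcOn-above-truncation σ (u-left ex) (lca-left-right ex ey) xy
      no-link-across ex ey (inj₂ yx) = ¬ArcOn-above-truncation σ (u-right ey) (lca-right-left ey ex) yx

      explains : ∀ {x y} → S x ≡ true → S y ≡ true → Edge G x y ⇔ LinkOn σ S ℓ u x y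
      explains {x} {y} sx sy with true-or-false (S₁ x) | true-or-false (S₁ y)
      ... | inj₁ ex | inj₁ ey = Left.linkOn⇔ ex ey ⇔-∘ R₁.explains ex ey
      ... | inj₂ ex | inj₂ ey = let sx′ = ∈∉⇒∈∖ sx ex ; sy′ = ∈∉⇒∈∖ sy ey in
                                Right.linkOn⇔ sx′ sy′ ⇔-∘ R₂.explains sx′ sy′
      ... | inj₁ ex | inj₂ ey = both-absurd (separated ex (∈∉⇒∈∖ sy ey)) (no-link-across ex ey)
      ... | inj₂ ex | inj₁ ey =
              explains-sym (both-absurd (separated ey (∈∉⇒∈∖ sx ex)) (no-link-across ey ex))

  attach-heart : ∀ {S v} → S v ≡ true → (∀ w → S w ≡ true → σ w ≢ σ v → Edge G v w) →
                 Representation (S ∖ ⁅ v ⁆) → Representation S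
  attach-heart {S} {v} sv heart R = record
    { labelling = labelling ; u = u ; u≼ℓ = u≼ℓ ; explains = explains }
    where
      module R = Representation R

      v-only : ∀ y → ⁅ v ⁆ y ≡ true → y ≡ v
      v-only y = x∈⁅y⁆⇒x≡y

      ⁅v⁆⊆S : ⁅ v ⁆ ⊆ S
      ⁅v⁆⊆S y e = subst (λ w → S w ≡ true) (sym (v-only y e)) sv

      open Join ⁅v⁆⊆S (point (x∈⁅x⁆ v) v-only) R.labelling

      truncation : Bool → Vtx R.shape → Vtx shape
      truncation true  _ = root
      truncation false a = child (suc zero) a

      u : Fin n → Vtx shape
      u x = truncation (⁅ v ⁆ x) (R.u x)

      u≼ℓ : ∀ x → u x ≼ ℓ x
      u≼ℓ x with ⁅ v ⁆ x
      ... | true  = root≼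
      ... | false = child≼ (R.u≼ℓ x)

      u-v : u v ≡ root
      u-v = cong (λ s → truncation s (R.u v)) (x∈⁅x⁆ v)

      u-right : ∀ {x} → ⁅ v ⁆ x ≡ false → u x ≡ child (suc zero) (R.u x)
      u-right {x} e = cong (λ s → truncation s (R.u x)) e

      module Right = Branch σ (suc zero) ∖-⊆ (λ e → ℓ-right (∈∖⇒∉ e)) (λ e → u-right (∈∖⇒∉ e))
                       (λ sx sz ez → lca-right-left (∈∖⇒∉ sx) (∉∖⇒∈ sz ez))

      arc-from-v : ∀ {y} → σ v ≢ σ y → ArcOn σ S ℓ u v y
      arc-from-v {y} σv≢σy = arcOn σv≢σy best (subst (_≼ lca (ℓ v) (ℓ y)) (sym u-v) root≼)
        where
          best : ∀ z → S z ≡ true → σ z ≡ σ y → lca (ℓ v) (ℓ z) ≼ lca (ℓ v) (ℓ y)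
          best z sz σz with true-or-false (⁅ v ⁆ z)
          ... | inj₁ ez = ⊥-elim (σv≢σy (trans (cong σ (sym (v-only z ez))) σz))
          ... | inj₂ ez = subst (_≼ _) (sym (lca-left-right (x∈⁅x⁆ v) ez)) root≼

      explains-v : ∀ {y} → (S ∖ ⁅ v ⁆) y ≡ true → Edge G v y ⇔ LinkOn σ S ℓ u v y
      explains-v {y} s₂y = mk⇔ (λ e → inj₁ (arc-from-v (σ-proper e))) from
        where
          from : LinkOn σ S ℓ u v y → Edge G v y
          from (inj₁ (arcOn σv≢σy _ _)) = heart y (∖-⊆ y s₂y) (λ eq → σv≢σy (sym eq))
          from (inj₂ yv) = ⊥-elim (¬ArcOn-above-truncation σ (u-right (∈∖⇒∉ s₂y))
                                     (lca-right-left (∈∖⇒∉ s₂y) (x∈⁅x⁆ v)) yv)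

      explains : ∀ {x y} → S x ≡ true → S y ≡ true → Edge G x y ⇔ LinkOn σ S ℓ u x y
      explains {x} {y} sx sy with true-or-false (⁅ v ⁆ x) | true-or-false (⁅ v ⁆ y)
      ... | inj₁ ex | inj₁ ey = subst (λ y → Edge G x y ⇔ LinkOn σ S ℓ u x y)
                                      (trans (v-only x ex) (sym (v-only y ey))) explains-loop
      ... | inj₁ ex | inj₂ ey = subst (λ x → Edge G x y ⇔ LinkOn σ S ℓ u x y)
                                      (sym (v-only x ex)) (explains-v (∈∉⇒∈∖ sy ey))
      ... | inj₂ ex | inj₁ ey = subst (λ y → Edge G x y ⇔ LinkOn σ S ℓ u x y)
                                      (sym (v-only y ey)) (explains-sym (explains-v (∈∉⇒∈∖ sx ex)))
      ... | inj₂ ex | inj₂ ey = let sx′ = ∈∉⇒∈∖ sx ex ; sy′ = ∈∉⇒∈∖ sy ey in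
                                Right.linkOn⇔ sx′ sy′ ⇔-∘ R.explains sx′ sy′

  -- Connected components, computed by growing the set of vertices reached from x₀

  record Reached (S : Fin n → Bool) (x₀ : Fin n) : Set where
    constructor reached
    field
      member   : Fin n → Bool
      member⊆S : member ⊆ S
      x₀∈      : member x₀ ≡ true
      walk     : ∀ {y} → member y ≡ true → Walk G S x₀ y

  Closed : (S R : Fin n → Bool) → Set
  Closed S R = ∀ {z y} → R z ≡ true → S y ≡ true → Edge G z y → R y ≡ true

  module Exploration {S : Fin n → Bool} {x₀} (s₀ : S x₀ ≡ true) where

    neighbour? : (R : Fin n → Bool) (y : Fin n) → Dec (∃ λ z → R z ∧ Graph.adj G z y ≡ true)
    neighbour? R y = any? (λ z → (R z ∧ Graph.adj G z y) ≟ᵇ true)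

    grow : (Fin n → Bool) → Fin n → Bool
    grow R y = R y ∨ (S y ∧ does (neighbour? R y))

    grow-⊇ : ∀ R → R ⊆ grow R
    grow-⊇ R y e rewrite e = refl

    grow-adjacent : ∀ R {z y} → R z ≡ true → S y ≡ true → Edge G z y → grow R y ≡ true
    grow-adjacent R {z} {y} rz sy e
      rewrite sy | dec-true (neighbour? R y) (z , ∧-intro rz e) = ∨-zeroʳ (R y)

    grown : ∀ R {y} → grow R y ≡ true →
            R y ≡ true ⊎ (S y ≡ true × ∃ λ z → R z ≡ true × Edge G z y)
    grown R {y} e with ∨-elim (R y) e
    ... | inj₁ ry  = inj₁ ry
    ... | inj₂ new with ∧-elim (S y) new
    ...   | sy , found with does⇒ (neighbour? R y) found
    ...     | z , rz∧e = inj₂ (sy , z , ∧-elim (R z) rz∧e)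

    grow-step : Reached S x₀ → Reached S x₀
    grow-step (reached R R⊆S x₀∈R walk) = reached (grow R) grow⊆S (grow-⊇ R x₀ x₀∈R) grow-walk
      where
        grow⊆S : grow R ⊆ S
        grow⊆S y e with grown R e
        ... | inj₁ ry       = R⊆S y ry
        ... | inj₂ (sy , _)     = sy

        grow-walk : ∀ {y} → grow R y ≡ true → Walk G S x₀ y
        grow-walk e with grown R e
        ... | inj₁ ry                  = walk ry
        ... | inj₂ (sy , _ , rz , ezy) = walk-snoc (walk rz) sy ezy

    -- Each non-final round adds a vertex, so n rounds suffice.
    explore : ∀ k (C : Reached S x₀) → n ≤ size (Reached.member C) + k →
              Σ[ C ∈ Reached S x₀ ] Closed S (Reached.member C)
    explore k C@(reached R _ _ _) bound with any? (λ y → (grow R y ≟ᵇ true) ×-dec (R y ≟ᵇ false))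
    ... | no stable = C , closed
      where
        closed : Closed S R
        closed {y = y} rz sy e with true-or-false (R y)
        ... | inj₁ ry = ry
        ... | inj₂ ry = ⊥-elim (stable (y , grow-adjacent R rz sy e , ry))
    ... | yes (y , gy , ry) with size-< (grow-⊇ R) gy ry | k
    ...   | grows | zero   =
            ⊥-elim (<⇒≱ grows (≤-trans (size≤n _) (subst (n ≤_) (+-identityʳ _) bound)))
    ...   | grows | suc k′ = explore k′ (grow-step C) (begin
      n                    ≤⟨ bound ⟩
      size R + suc k′      ≡⟨ +-suc _ k′ ⟩
      suc (size R) + k′    ≤⟨ +-monoˡ-≤ k′ grows ⟩
      size (grow R) + k′   ∎)
      where open ≤-Reasoning

    component : Σ[ C ∈ Reached S x₀ ] Closed S (Reached.member C)
    component = explore n start (m≤n+m n _)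
      where
        start : Reached S x₀
        start = reached ⁅ x₀ ⁆ (λ y e → subst (λ w → S w ≡ true) (sym (x∈⁅y⁆⇒x≡y e)) s₀)
                        (x∈⁅x⁆ x₀) (λ e → subst (Walk G S x₀) (sym (x∈⁅y⁆⇒x≡y e)) (stop s₀))

  module _ (hearts : EveryConnectedInducedHasHeart G) where

    RepresentableBelow : ℕ → Set
    RepresentableBelow k = ∀ {S} → size S < k → ∀ {x₀} → S x₀ ≡ true → Representation S

    represent-disconnected : ∀ {k S S₁ x₀ y} → RepresentableBelow k → size S ≤ k →
      S₁ ⊆ S → Closed S S₁ → S₁ x₀ ≡ true → S y ≡ true → S₁ y ≡ false → Representation S
    represent-disconnected {S = S} {S₁} IH size≤k S₁⊆S closed x₀∈ sy y∉ =
      union S₁⊆S separated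
        (IH (<-≤-trans (size-< S₁⊆S sy y∉) size≤k) x₀∈)
        (IH (<-≤-trans (size-< ∖-⊆ (S₁⊆S _ x₀∈) (∈⇒∉∖ x₀∈)) size≤k) (∈∉⇒∈∖ sy y∉))
      where
        separated : ∀ {x y} → S₁ x ≡ true → (S ∖ S₁) y ≡ true → ¬ Edge G x y
        separated {y = y} x∈ y∈ e with trans (sym (closed x∈ (∖-⊆ y y∈) e)) (∈∖⇒∉ y∈)
        ... | ()

    represent-connected : ∀ {k S x₀} → RepresentableBelow k → size S ≤ k → S x₀ ≡ true →
      (∀ x y → S x ≡ true → S y ≡ true → Walk G S x y) → Representation S
    represent-connected {S = S} {x₀} IH size≤k s₀ connected
      with hearts S ((x₀ , s₀) , connected) σ (λ _ _ _ _ → σ-proper)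
    ... | v , sv , heart with any? (λ y → (S y ≟ᵇ true) ×-dec ¬? (y ≟ v))
    ...   | yes (y , sy , y≢v) =
            attach-heart sv heart
              (IH (<-≤-trans (size-< ∖-⊆ sv (∈⇒∉∖ (x∈⁅x⁆ v))) size≤k)
                  (∈∉⇒∈∖ sy (x≢y⇒x∉⁅y⁆ y≢v)))
    ...   | no alone =
            singleton sv λ y sy → decidable-stable (y ≟ v) λ y≢v → alone (y , sy , y≢v)

    represent : ∀ k {S} → size S < k → ∀ {x₀} → S x₀ ≡ true → Representation S
    represent (suc k) {S} (s≤s size≤k) s₀ with Exploration.component s₀
    ... | reached C C⊆S x₀∈C walk , closed with any? (λ y → (S y ≟ᵇ true) ×-dec (C y ≟ᵇ false))
    ...   | yes (y , sy , y∉C) = represent-disconnected (represent k) size≤k C⊆S closed x₀∈C sy y∉C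
    ...   | no spans = represent-connected (represent k) size≤k s₀ λ x y sx sy →
                         walk-reverse-onto (walk (covers sx)) (walk (covers sy))
      where
        covers : ∀ {y} → S y ≡ true → C y ≡ true
        covers {y} sy with true-or-false (C y)
        ... | inj₁ y∈C = y∈C
        ... | inj₂ y∉C = ⊥-elim (spans (y , sy , y∉C))

  representation⇒un2qBMG : Representation (λ _ → true) → Un2qBMG G
  representation⇒un2qBMG R = σ , T , (u , u≼ℓ) , λ x y →
      (arcOn⇔arc ⊎-⇔ arcOn⇔arc) ⇔-∘ explains refl refl
    where
      open Representation R

      T : PhyloTree n
      T = record
        { tree       = shape
        ; label      = ℓ
        ; label-leaf = λ x → ℓ-leaf x refl
        ; label-inj  = λ x y → ℓ-injective x y refl refl
        ; label-surj = λ w l → let x , _ , eq = ℓ-onto w l in x , eq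
        }

      arcOn⇔arc : ∀ {x y} → ArcOn σ (λ _ → true) ℓ u x y ⇔ Arc T σ (u , u≼ℓ) x y
      arcOn⇔arc = mk⇔ (λ (arcOn colours best truncated) → colours , (λ z → best z refl) , truncated)
                      (λ (colours , best , truncated) → arcOn colours (λ z _ → best z) truncated)

backward : ∀ {n} (G : Graph n) → 1 ≤ n → Bipartite G → EveryConnectedInducedHasHeart G → Un2qBMG G
backward {suc m} G _ (σ , σ-proper) hearts =
  representation⇒un2qBMG (represent hearts (suc (suc m)) (s≤s (size≤n _)) {zero} refl)
  where open Construction G σ (λ {x} {y} → σ-proper x y refl refl)

theorem5p6 : ∀ {n : ℕ} (G : Graph n) → 1 ≤ n → Bipartite G →
    (Un2qBMG G ⇔ EveryConnectedInducedHasHeart G)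
theorem5p6 G n≥1 bipartite = mk⇔ (forward G) (backward G n≥1 bipartite)
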